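{- Let $q$ be a prime power and let $x^d\in\mathbb{F}_q[x]$ be a permutation monomial whose compositional inverse (as a permutation of $\mathbb{F}_q$) is induced by $x^e$. Then $x^{d+1}$ is projectively equivalent to $x^{e+1}$.
   Context: For $u\in\mathbb{F}_q[x]$, $S_u=\{(x,u(x),1):x\in\mathbb{F}_q\}\cup\{(0,1,0)\}\subset\mathrm{PG}(2,q)$, the projective plane over $\mathbb{F}_q$. Two polynomials $u_1,u_2$ are projectively equivalent if some collineation of $\mathrm{PG}(2,q)$ (element of $\mathrm{P\Gamma L}(3,q)$) maps $S_{u_1}$ onto $S_{u_2}$. A permutation monomial is a monomial inducing a bijection of $\mathbb{F}_q$. -}

module Defs where

open import Level using (Level; _⊔_) renaming (suc to lsuc)
open import Data.Nat using (ℕ; zero; suc)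
open import Data.Fin using (Fin; zero; suc)
open import Data.Product using (Σ; ∃; _×_; _,_)
open import Data.Sum using (_⊎_)
open import Relation.Nullary using (¬_)
open import Relation.Binary.PropositionalEquality using (_≡_)
open import Relation.Binary.Definitions using (Decidable)
open import Algebra.Bundles using (CommutativeRing)

record FiniteField (q : ℕ) (c ℓ : Level) : Set (lsuc (c ⊔ ℓ)) where
  field
    commRing : CommutativeRing c ℓ
  open CommutativeRing commRing public hiding (ring)
  field
    1≉0             : ¬ (1# ≈ 0#)
    inverse         : ∀ x → ¬ (x ≈ 0#) → ∃ λ y → x * y ≈ 1#
    _≟_             : Decidable _≈_
    enum            : Fin q → Carrier
    enum-injective  : ∀ i j → enum i ≈ enum j → i ≡ j
    enum-surjective : ∀ x → ∃ λ i → enum i ≈ x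

module Geometry {q : ℕ} {c ℓ : Level} (F : FiniteField q c ℓ) where
  open FiniteField F hiding (zero)

  pow : Carrier → ℕ → Carrier
  pow x zero    = 1#
  pow x (suc n) = x * pow x n

  Vec3 : Set c
  Vec3 = Fin 3 → Carrier

  vec : Carrier → Carrier → Carrier → Vec3
  vec a b d zero             = a
  vec a b d (suc zero)       = b
  vec a b d (suc (suc zero)) = d

  -- same projective point: v = k w for a nonzero scalar k
  _∼_ : Vec3 → Vec3 → Set (c ⊔ ℓ)
  v ∼ w = ∃ λ k → ¬ (k ≈ 0#) × (∀ i → v i ≈ k * w i)

  -- S_u = {(x, u(x), 1) : x ∈ F_q} ∪ {(0,1,0)}, as a set of projective points
  -- (a vector lies in S_u iff it represents one of these points)
  S : (Carrier → Carrier) → Vec3 → Set (c ⊔ ℓ)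
  S u v = (∃ λ x → v ∼ vec x (u x) 1#) ⊎ (v ∼ vec 0# 1# 0#)

  Mat3 : Set c
  Mat3 = Fin 3 → Fin 3 → Carrier

  det : Mat3 → Carrier
  det M = (m 0 0 * (m 1 1 * m 2 2 - m 1 2 * m 2 1)
        - m 0 1 * (m 1 0 * m 2 2 - m 1 2 * m 2 0))
        + m 0 2 * (m 1 0 * m 2 1 - m 1 1 * m 2 0)
    where
      fin : ℕ → Fin 3
      fin zero          = zero
      fin (suc zero)    = suc zero
      fin (suc (suc _)) = suc (suc zero)
      m : ℕ → ℕ → Carrier
      m i j = M (fin i) (fin j)

  record Automorphism : Set (c ⊔ ℓ) where
    field
      σ        : Carrier → Carrier
      σ-cong   : ∀ {x y} → x ≈ y → σ x ≈ σ y
      σ-+      : ∀ x y → σ (x + y) ≈ σ x + σ y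
      σ-*      : ∀ x y → σ (x * y) ≈ σ x * σ y
      σ-1      : σ 1# ≈ 1#
      σ-inj    : ∀ {x y} → σ x ≈ σ y → x ≈ y
      σ-surj   : ∀ y → ∃ λ x → σ x ≈ y

  record Collineation : Set (c ⊔ ℓ) where
    field
      aut    : Automorphism
      M      : Mat3
      det≉0  : ¬ (det M ≈ 0#)
    open Automorphism aut
    act : Vec3 → Vec3
    act v i = (M i zero * σ (v zero) + M i (suc zero) * σ (v (suc zero)))
              + M i (suc (suc zero)) * σ (v (suc (suc zero)))

  MapsOnto : (Vec3 → Vec3) → (Vec3 → Set (c ⊔ ℓ)) → (Vec3 → Set (c ⊔ ℓ)) → Set (c ⊔ ℓ)
  MapsOnto g P Q = (∀ v → P v → Q (g v)) × (∀ w → Q w → ∃ λ v → P v × (g v ∼ w))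

  ProjectivelyEquivalent : (Carrier → Carrier) → (Carrier → Carrier) → Set (c ⊔ ℓ)
  ProjectivelyEquivalent u₁ u₂ =
    ∃ λ (C : Collineation) → MapsOnto (Collineation.act C) (S u₁) (S u₂)

  IsPermutationMonomial : ℕ → Set (c ⊔ ℓ)
  IsPermutationMonomial d =
    (∀ x y → pow x d ≈ pow y d → x ≈ y) × (∀ y → ∃ λ x → pow x d ≈ y)

{-# OPTIONS --safe #-}
module Submission where

open import Defs
open import Level using (Level)
open import Data.Nat using (ℕ; zero; suc)
open import Data.Product using (_,_)
open import Data.Sum using (inj₁; inj₂)
open import Data.Fin.Patterns using (0F; 1F; 2F)
open import Relation.Nullary using (¬_; yes; no)
open import Algebra.Bundles using (CommutativeRing)

-- The transposition τ : (x : y : z) ↦ (x : z : y) of the last two coordinates does it.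
-- It exchanges (0, 0, 1) and (0, 1, 0), and for x ≠ 0 it sends (x, x^(d+1), 1) to
-- (x, 1, x^(d+1)) = x^(d+1) · (t, t^(e+1), 1) with t = x^(-d), because t^e = x^(-1).
-- Since τ is an involution, the reverse inclusion is the same computation with d and
-- e exchanged.

module Projective {q : ℕ} {c ℓ : Level} (F : FiniteField q c ℓ) where
  open FiniteField F hiding (zero)
  open Geometry F
  open import Algebra.Properties.Ring (CommutativeRing.ring commRing) using (-0#≈0#; -‿injective)
  open import Relation.Binary.Reasoning.Setoid setoid

  x*y≈1⇒x≉0 : ∀ {x y} → x * y ≈ 1# → ¬ (x ≈ 0#)
  x*y≈1⇒x≉0 {x} {y} x*y≈1 x≈0 = 1≉0 (begin
    1#     ≈⟨ x*y≈1 ⟨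
    x * y  ≈⟨ *-congʳ x≈0 ⟩
    0# * y ≈⟨ zeroˡ y ⟩
    0#     ∎)

  x*y≉0 : ∀ {x y} → ¬ (x ≈ 0#) → ¬ (y ≈ 0#) → ¬ (x * y ≈ 0#)
  x*y≉0 {x} {y} x≉0 y≉0 x*y≈0 with inverse x x≉0
  ... | x⁻¹ , x*x⁻¹≈1 = y≉0 (begin
    y              ≈⟨ *-identityˡ y ⟨
    1# * y         ≈⟨ *-congʳ (trans (*-comm x⁻¹ x) x*x⁻¹≈1) ⟨
    (x⁻¹ * x) * y  ≈⟨ *-assoc x⁻¹ x y ⟩
    x⁻¹ * (x * y)  ≈⟨ *-congˡ x*y≈0 ⟩
    x⁻¹ * 0#       ≈⟨ zeroʳ x⁻¹ ⟩
    0#             ∎)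

  x*y≈1⇒xⁿ*yⁿ≈1 : ∀ {x y} n → x * y ≈ 1# → pow x n * pow y n ≈ 1#
  x*y≈1⇒xⁿ*yⁿ≈1 zero _ = *-identityˡ 1#
  x*y≈1⇒xⁿ*yⁿ≈1 {x} {y} (suc n) x*y≈1 = begin
    (x * pow x n) * (y * pow y n)  ≈⟨ interchange x (pow x n) y (pow y n) ⟩
    (x * y) * (pow x n * pow y n)  ≈⟨ *-cong x*y≈1 (x*y≈1⇒xⁿ*yⁿ≈1 n x*y≈1) ⟩
    1# * 1#                        ≈⟨ *-identityˡ 1# ⟩
    1#                             ∎
    where open import Algebra.Properties.CommutativeSemigroup *-commutativeSemigroup
            using (interchange)

  pointwise⇒∼ : ∀ {v w} → (∀ i → v i ≈ w i) → v ∼ w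
  pointwise⇒∼ v≈w = 1# , 1≉0 , λ i → trans (v≈w i) (sym (*-identityˡ _))

  vec-cong-∼ : ∀ {a a′ b b′ d d′} → a ≈ a′ → b ≈ b′ → d ≈ d′ → vec a b d ∼ vec a′ b′ d′
  vec-cong-∼ a≈a′ b≈b′ d≈d′ = pointwise⇒∼ λ { 0F → a≈a′ ; 1F → b≈b′ ; 2F → d≈d′ }

  ∼-trans : ∀ {u v w} → u ∼ v → v ∼ w → u ∼ w
  ∼-trans {w = w} (k , k≉0 , u≈kv) (l , l≉0 , v≈lw) = k * l , x*y≉0 k≉0 l≉0 , λ i →
    trans (u≈kv i) (trans (*-congˡ (v≈lw i)) (sym (*-assoc k l (w i))))

  S-resp-∼ : ∀ {u v w} → v ∼ w → S u w → S u v
  S-resp-∼ v∼w (inj₁ (x , w∼p)) = inj₁ (x , ∼-trans v∼w w∼p)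
  S-resp-∼ v∼w (inj₂ w∼p)       = inj₂ (∼-trans v∼w w∼p)

  rescale-to-affine : ∀ {x X t T} → X * t ≈ x → X * T ≈ 1# → vec x 1# X ∼ vec t T 1#
  rescale-to-affine {X = X} X*t≈x X*T≈1 =
    X , x*y≈1⇒x≉0 X*T≈1 , λ { 0F → sym X*t≈x ; 1F → sym X*T≈1 ; 2F → sym (*-identityʳ X) }

  mapsOnto-involution : ∀ {g P Q} → (∀ v → g (g v) ∼ v) →
                        (∀ v → P v → Q (g v)) → (∀ w → Q w → P (g w)) → MapsOnto g P Q
  mapsOnto-involution {g} g∘g∼id P→Q Q→P = P→Q , λ w Q-w → g w , Q→P w Q-w , g∘g∼id w

  swap : Vec3 → Vec3
  swap v = vec (v 0F) (v 2F) (v 1F)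

  swap-resp-∼ : ∀ {v w} → v ∼ w → swap v ∼ swap w
  swap-resp-∼ (k , k≉0 , v≈kw) = k , k≉0 , λ { 0F → v≈kw 0F ; 1F → v≈kw 2F ; 2F → v≈kw 1F }

  swapMatrix : Mat3
  swapMatrix 0F 0F = 1#
  swapMatrix 1F 2F = 1#
  swapMatrix 2F 1F = 1#
  swapMatrix _  _  = 0#

  det-swapMatrix : det swapMatrix ≈ - 1#
  det-swapMatrix = begin
    (1# * (0# * 0# - 1# * 1#) - 0# * (0# * 0# - 1# * 0#)) + 0# * (0# * 1# - 0# * 0#)
      ≈⟨ +-cong (+-congˡ (-‿cong (zeroˡ _))) (zeroˡ _) ⟩
    (1# * (0# * 0# - 1# * 1#) - 0#) + 0#
      ≈⟨ trans (+-identityʳ _) (trans (+-congˡ -0#≈0#) (+-identityʳ _)) ⟩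
    1# * (0# * 0# - 1# * 1#)
      ≈⟨ *-identityˡ _ ⟩
    0# * 0# - 1# * 1#
      ≈⟨ +-cong (zeroˡ 0#) (-‿cong (*-identityˡ 1#)) ⟩
    0# - 1#
      ≈⟨ +-identityˡ (- 1#) ⟩
    - 1#
      ∎

  -1≉0 : ¬ (- 1# ≈ 0#)
  -1≉0 -1≈0 = 1≉0 (-‿injective (trans -1≈0 (sym -0#≈0#)))

  identityAutomorphism : Automorphism
  identityAutomorphism = record
    { σ = λ x → x ; σ-cong = λ x≈y → x≈y ; σ-+ = λ _ _ → refl ; σ-* = λ _ _ → refl
    ; σ-1 = refl ; σ-inj = λ x≈y → x≈y ; σ-surj = λ y → y , refl }

  swapCollineation : Collineation
  swapCollineation = record
    { aut = identityAutomorphism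
    ; M = swapMatrix
    ; det≉0 = λ det≈0 → -1≉0 (trans (sym det-swapMatrix) det≈0)
    }

  open Collineation swapCollineation using (act)

  act≈swap : ∀ v i → act v i ≈ swap v i
  act≈swap v 0F = trans (+-cong (+-cong (*-identityˡ _) (zeroˡ _)) (zeroˡ _))
                        (trans (+-identityʳ _) (+-identityʳ _))
  act≈swap v 1F = trans (+-cong (+-cong (zeroˡ _) (zeroˡ _)) (*-identityˡ _))
                        (trans (+-congʳ (+-identityʳ 0#)) (+-identityˡ _))
  act≈swap v 2F = trans (+-cong (+-cong (zeroˡ _) (*-identityˡ _)) (zeroˡ _))
                        (trans (+-identityʳ _) (+-identityˡ _))

  act-involutive : ∀ v → act (act v) ∼ v
  act-involutive v = pointwise⇒∼ λ
    { 0F → trans (act≈swap (act v) 0F) (act≈swap v 0F)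
    ; 1F → trans (act≈swap (act v) 1F) (act≈swap v 2F)
    ; 2F → trans (act≈swap (act v) 2F) (act≈swap v 1F)
    }

  monomial : ℕ → Carrier → Carrier
  monomial n x = pow x n

  module _ (d e : ℕ) (xᵈᵉ≈x : ∀ x → pow (pow x d) e ≈ x) where

    swapped-graph-point : ∀ {x y} → x * y ≈ 1# →
      vec x 1# (pow x (suc d)) ∼ vec (pow y d) (pow (pow y d) (suc e)) 1#
    swapped-graph-point {x} {y} x*y≈1 = rescale-to-affine X*t≈x X*tᵉ⁺¹≈1
      where
      X = pow x (suc d)
      t = pow y d
      X*t≈x : X * t ≈ x
      X*t≈x = begin
        (x * pow x d) * t  ≈⟨ *-assoc x (pow x d) t ⟩
        x * (pow x d * t)  ≈⟨ *-congˡ (x*y≈1⇒xⁿ*yⁿ≈1 d x*y≈1) ⟩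
        x * 1#             ≈⟨ *-identityʳ x ⟩
        x                  ∎
      X*tᵉ⁺¹≈1 : X * pow t (suc e) ≈ 1#
      X*tᵉ⁺¹≈1 = begin
        X * (t * pow t e)  ≈⟨ *-congˡ (*-congˡ (xᵈᵉ≈x y)) ⟩
        X * (t * y)        ≈⟨ *-assoc X t y ⟨
        (X * t) * y        ≈⟨ *-congʳ X*t≈x ⟩
        x * y              ≈⟨ x*y≈1 ⟩
        1#                 ∎

    swap-maps-graph : ∀ v → S (monomial (suc d)) v → S (monomial (suc e)) (swap v)
    swap-maps-graph v (inj₂ v∼∞) =
      inj₁ (0# , ∼-trans (swap-resp-∼ v∼∞) (vec-cong-∼ refl (sym (zeroˡ _)) refl))
    swap-maps-graph v (inj₁ (x , v∼p)) with x ≟ 0#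
    ... | yes x≈0 =
      inj₂ (∼-trans (swap-resp-∼ v∼p) (vec-cong-∼ x≈0 refl (trans (*-congʳ x≈0) (zeroˡ _))))
    ... | no x≉0 with inverse x x≉0
    ... | y , x*y≈1 = inj₁ (pow y d , ∼-trans (swap-resp-∼ v∼p) (swapped-graph-point x*y≈1))

    act-maps-graph : ∀ v → S (monomial (suc d)) v → S (monomial (suc e)) (act v)
    act-maps-graph v S-v = S-resp-∼ (pointwise⇒∼ (act≈swap v)) (swap-maps-graph v S-v)

corollary2p10 : {c ℓ : Level} (q : ℕ) (F : FiniteField q c ℓ) (d e : ℕ)
    → Geometry.IsPermutationMonomial F d
    → (∀ x → FiniteField._≈_ F (Geometry.pow F (Geometry.pow F x d) e) x)
    → (∀ x → FiniteField._≈_ F (Geometry.pow F (Geometry.pow F x e) d) x)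
    → Geometry.ProjectivelyEquivalent F (λ x → Geometry.pow F x (suc d))
                                        (λ x → Geometry.pow F x (suc e))
corollary2p10 q F d e _ xᵈᵉ≈x xᵉᵈ≈x =
  swapCollineation ,
  mapsOnto-involution act-involutive (act-maps-graph d e xᵈᵉ≈x) (act-maps-graph e d xᵉᵈ≈x)
  where open Projective F
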